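{- Let $(s_n(x))_{n\ge 0}$ be the polynomials defined by $s_0=0$, $s_1=2$, $s_2=2x$ and $s_n=2x\,s_{n-1}+s_{n-3}$ for $n\ge 3$. Then for all $n\ge 2$, $$s_n(x)=\sum_{0\le \ell\le (n-1)/3}(2x)^{n-1-3\ell}\,\frac{n-\ell-1}{n-2\ell-1}\binom{n-2\ell-1}{\ell}.$$
   Context: This is the second version of the third-order Pell polynomials of Mahon and Horadam. -}

module Defs where

open import Data.Nat as ℕ using (ℕ; zero; suc; _∸_; _/_)
open import Data.Nat.Combinatorics using (_C_)
open import Data.Integer using (+_)
open import Data.Rational as ℚ using (ℚ; 0ℚ; 1ℚ; _+_; _*_)
open import Data.List using (List; foldr; map; upTo)

2ℚ : ℚ
2ℚ = 1ℚ + 1ℚ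

s : ℕ → ℚ → ℚ
s zero x = 0ℚ
s (suc zero) x = 2ℚ
s (suc (suc zero)) x = 2ℚ * x
s (suc (suc (suc n))) x = (2ℚ * x) * s (suc (suc n)) x + s n x

infixr 8 _^_
_^_ : ℚ → ℕ → ℚ
q ^ zero = 1ℚ
q ^ suc k = q * (q ^ k)

sumℚ : List ℚ → ℚ
sumℚ = foldr _+_ 0ℚ

-- the rational number a / b; b = 0 never occurs in the theorem's range
-- (for n ≥ 2 and ℓ ≤ (n-1)/3 one has n - 2ℓ - 1 ≥ 1), and
-- is sent to 0 only to make the function total.
frac : ℕ → ℕ → ℚ
frac a zero = 0ℚ
frac a (suc b) = (+ a) ℚ./ suc b

term : ℕ → ℚ → ℕ → ℚ
term n x ℓ = ((2ℚ * x) ^ (n ∸ 1 ∸ 3 ℕ.* ℓ)) * (frac (n ∸ ℓ ∸ 1) (n ∸ 2 ℕ.* ℓ ∸ 1) * (+ ((n ∸ 2 ℕ.* ℓ ∸ 1) C ℓ) ℚ./ 1))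

rhs : ℕ → ℚ → ℚ
rhs n x = sumℚ (map (term n x) (upTo (suc ((n ∸ 1) / 3))))

{-# OPTIONS --safe #-}
-- With y = 2x, let N_m = Σ_ℓ C(m-2ℓ, ℓ) y^(m-3ℓ). Pascal's rule gives N_{m+3} = y N_{m+2} + N_m,
-- the recurrence of s_{m+1}, so comparing three initial values yields s_{m+1} = N_m + N_{m-3}
-- (N continued backwards along the recurrence). On the other side, the absorption identity
-- ℓ C(k,ℓ) = k C(k-1,ℓ-1) splits the ℓ-th summand of the formula, with k = m - 2ℓ, as
-- (k+ℓ)/k · C(k,ℓ) y^(m-3ℓ) = C(k,ℓ) y^(m-3ℓ) + C(k-1,ℓ-1) y^(m-3ℓ),
-- and the two parts sum to N_m and N_{m-3} respectively.
module Submission where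

open import Defs
open import Data.Nat.Base as ℕ using (ℕ; zero; suc; _≤_; _<_; _∸_; z≤n; s≤s)
import Data.Nat.Properties as ℕ
import Data.Nat.DivMod as ℕ
open import Data.Nat.Combinatorics
  using (_C_; k>n⇒nCk≡0; nC1≡n; nCn≡1; nCk+nC[k+1]≡[n+1]C[k+1])
open import Data.Nat.Tactic.RingSolver using (solve-∀)
import Data.Integer.Base as ℤ
import Data.Integer.Properties as ℤ
open import Data.Rational.Base as ℚ using (ℚ; 0ℚ; 1ℚ; _+_; _*_; fromℚᵘ; toℚᵘ)
import Data.Rational.Properties as ℚ
open import Data.Rational.Unnormalised.Base as ℚᵘ using (mkℚᵘ; *≡*)
import Data.Rational.Unnormalised.Properties as ℚᵘ
open import Data.List.Base using (map; applyUpTo)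
open import Data.Product.Base using (_,_)
open import Data.Sum.Base using (inj₁; inj₂)
open import Function.Base using (_∘_)
open import Relation.Binary.PropositionalEquality
open import Algebra.Bundles using (CommutativeMonoid)
open import Algebra.Properties.CommutativeSemigroup
  (CommutativeMonoid.commutativeSemigroup ℚ.+-0-commutativeMonoid) using (interchange)

Σ : (ℕ → ℚ) → ℕ → ℚ
Σ f zero    = 0ℚ
Σ f (suc K) = f 0 + Σ (f ∘ suc) K

sumℚ-map-applyUpTo : ∀ (f : ℕ → ℚ) g K → sumℚ (map f (applyUpTo g K)) ≡ Σ (f ∘ g) K
sumℚ-map-applyUpTo f g zero    = refl
sumℚ-map-applyUpTo f g (suc K) = cong (f (g 0) +_) (sumℚ-map-applyUpTo f (g ∘ suc) K)

Σ-cong : ∀ {f g : ℕ → ℚ} K → (∀ ℓ → ℓ < K → f ℓ ≡ g ℓ) → Σ f K ≡ Σ g K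
Σ-cong zero    eq = refl
Σ-cong (suc K) eq = cong₂ _+_ (eq 0 (s≤s z≤n)) (Σ-cong K (λ ℓ ℓ<K → eq (suc ℓ) (s≤s ℓ<K)))

Σ-distrib-+ : ∀ (f g : ℕ → ℚ) K → Σ (λ ℓ → f ℓ + g ℓ) K ≡ Σ f K + Σ g K
Σ-distrib-+ f g zero    = refl
Σ-distrib-+ f g (suc K) = trans (cong (f 0 + g 0 +_) (Σ-distrib-+ (f ∘ suc) (g ∘ suc) K))
                                 (interchange (f 0) (g 0) (Σ (f ∘ suc) K) (Σ (g ∘ suc) K))

*-distribˡ-Σ : ∀ c (f : ℕ → ℚ) K → c * Σ f K ≡ Σ (λ ℓ → c * f ℓ) K
*-distribˡ-Σ c f zero    = ℚ.*-zeroʳ c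
*-distribˡ-Σ c f (suc K) = trans (ℚ.*-distribˡ-+ c (f 0) (Σ (f ∘ suc) K))
                                  (cong (c * f 0 +_) (*-distribˡ-Σ c (f ∘ suc) K))

Σ-zero : ∀ (f : ℕ → ℚ) K → (∀ ℓ → f ℓ ≡ 0ℚ) → Σ f K ≡ 0ℚ
Σ-zero f zero    f≡0 = refl
Σ-zero f (suc K) f≡0 = cong₂ _+_ (f≡0 0) (Σ-zero (f ∘ suc) K (f≡0 ∘ suc))

Σ-extend : ∀ (f : ℕ → ℚ) {K K′} → (∀ ℓ → K ≤ ℓ → f ℓ ≡ 0ℚ) → K ≤ K′ → Σ f K′ ≡ Σ f K
Σ-extend f {K′ = K′} f≡0 z≤n = Σ-zero f K′ (λ ℓ → f≡0 ℓ z≤n)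
Σ-extend f f≡0 (s≤s K≤K′) = cong (f 0 +_) (Σ-extend (f ∘ suc) (λ ℓ K≤ℓ → f≡0 (suc ℓ) (s≤s K≤ℓ)) K≤K′)

shift : (ℕ → ℚ) → ℕ → ℚ
shift f zero    = 0ℚ
shift f (suc ℓ) = f ℓ

Σ-shift : ∀ (f : ℕ → ℚ) K → Σ (shift f) (suc K) ≡ Σ f K
Σ-shift f K = ℚ.+-identityˡ (Σ f K)

-- Opaque because unfolding ι exposes the gcd normalisation of ℚ, which makes unification very slow.
opaque
  ι : ℕ → ℚ
  ι n = ℤ.+ n ℚ./ 1

fromℚᵘ-homo-+ : ∀ p q → fromℚᵘ (p ℚᵘ.+ q) ≡ fromℚᵘ p + fromℚᵘ q
fromℚᵘ-homo-+ p q = ℚ.toℚᵘ-injective (begin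
  toℚᵘ (fromℚᵘ (p ℚᵘ.+ q))              ≈⟨ ℚ.toℚᵘ-fromℚᵘ (p ℚᵘ.+ q) ⟩
  p ℚᵘ.+ q                               ≈⟨ ℚᵘ.+-cong (ℚᵘ.≃-sym (ℚ.toℚᵘ-fromℚᵘ p)) (ℚᵘ.≃-sym (ℚ.toℚᵘ-fromℚᵘ q)) ⟩
  toℚᵘ (fromℚᵘ p) ℚᵘ.+ toℚᵘ (fromℚᵘ q)  ≈⟨ ℚᵘ.≃-sym (ℚ.toℚᵘ-homo-+ (fromℚᵘ p) (fromℚᵘ q)) ⟩
  toℚᵘ (fromℚᵘ p + fromℚᵘ q)            ∎)
  where open ℚᵘ.≃-Reasoning

fromℚᵘ-homo-* : ∀ p q → fromℚᵘ (p ℚᵘ.* q) ≡ fromℚᵘ p * fromℚᵘ q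
fromℚᵘ-homo-* p q = ℚ.toℚᵘ-injective (begin
  toℚᵘ (fromℚᵘ (p ℚᵘ.* q))              ≈⟨ ℚ.toℚᵘ-fromℚᵘ (p ℚᵘ.* q) ⟩
  p ℚᵘ.* q                               ≈⟨ ℚᵘ.*-cong (ℚᵘ.≃-sym (ℚ.toℚᵘ-fromℚᵘ p)) (ℚᵘ.≃-sym (ℚ.toℚᵘ-fromℚᵘ q)) ⟩
  toℚᵘ (fromℚᵘ p) ℚᵘ.* toℚᵘ (fromℚᵘ q)  ≈⟨ ℚᵘ.≃-sym (ℚ.toℚᵘ-homo-* (fromℚᵘ p) (fromℚᵘ q)) ⟩
  toℚᵘ (fromℚᵘ p * fromℚᵘ q)            ∎)
  where open ℚᵘ.≃-Reasoning

-- Under unfolding, ι n and frac a (suc t) are fromℚᵘ of the unnormalised fractions n/1 and a/(1+t).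
opaque
  unfolding ι

  ι-def : ∀ n → ι n ≡ ℤ.+ n ℚ./ 1
  ι-def n = refl

  ι-0 : ι 0 ≡ 0ℚ
  ι-0 = refl

  ι-1 : ι 1 ≡ 1ℚ
  ι-1 = refl

  ι-+ : ∀ a b → ι (a ℕ.+ b) ≡ ι a + ι b
  ι-+ a b = trans (ℚ.fromℚᵘ-cong {mkℚᵘ (ℤ.+ (a ℕ.+ b)) 0} {mkℚᵘ (ℤ.+ a) 0 ℚᵘ.+ mkℚᵘ (ℤ.+ b) 0}
                                 (*≡* (cong (ℤ._* ℤ.+ 1) +[a+b]≡a*1+b*1)))
                  (fromℚᵘ-homo-+ (mkℚᵘ (ℤ.+ a) 0) (mkℚᵘ (ℤ.+ b) 0))
    where
    +[a+b]≡a*1+b*1 : ℤ.+ (a ℕ.+ b) ≡ ℤ.+ a ℤ.* ℤ.+ 1 ℤ.+ ℤ.+ b ℤ.* ℤ.+ 1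
    +[a+b]≡a*1+b*1 =
      trans (ℤ.pos-+ a b) (sym (cong₂ ℤ._+_ (ℤ.*-identityʳ (ℤ.+ a)) (ℤ.*-identityʳ (ℤ.+ b))))

  frac-*-ι : ∀ a t c e → a ℕ.* c ≡ suc t ℕ.* e → frac a (suc t) * ι c ≡ ι e
  frac-*-ι a t c e ac≡[1+t]e =
    trans (sym (fromℚᵘ-homo-* (mkℚᵘ (ℤ.+ a) t) (mkℚᵘ (ℤ.+ c) 0)))
          (ℚ.fromℚᵘ-cong {mkℚᵘ (ℤ.+ a) t ℚᵘ.* mkℚᵘ (ℤ.+ c) 0} {mkℚᵘ (ℤ.+ e) 0} (*≡* cross))
    where
    cross : (ℤ.+ a ℤ.* ℤ.+ c) ℤ.* ℤ.+ 1 ≡ ℤ.+ e ℤ.* ℤ.+ (suc t ℕ.* 1)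
    cross = begin
      (ℤ.+ a ℤ.* ℤ.+ c) ℤ.* ℤ.+ 1   ≡⟨ ℤ.*-identityʳ _ ⟩
      ℤ.+ a ℤ.* ℤ.+ c               ≡⟨ ℤ.pos-* a c ⟨
      ℤ.+ (a ℕ.* c)                 ≡⟨ cong ℤ.+_ (trans ac≡[1+t]e (ℕ.*-comm (suc t) e)) ⟩
      ℤ.+ (e ℕ.* suc t)             ≡⟨ cong (λ d → ℤ.+ (e ℕ.* d)) (ℕ.*-identityʳ (suc t)) ⟨
      ℤ.+ (e ℕ.* (suc t ℕ.* 1))     ≡⟨ ℤ.pos-* e (suc t ℕ.* 1) ⟩
      ℤ.+ e ℤ.* ℤ.+ (suc t ℕ.* 1)   ∎
      where open ≡-Reasoning

[1+k]*[1+n]C[1+k]≡[1+n]*nCk : ∀ n k → suc k ℕ.* (suc n C suc k) ≡ suc n ℕ.* (n C k)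
[1+k]*[1+n]C[1+k]≡[1+n]*nCk zero    zero    = refl
[1+k]*[1+n]C[1+k]≡[1+n]*nCk zero    (suc k) = ℕ.*-zeroʳ (2 ℕ.+ k)
[1+k]*[1+n]C[1+k]≡[1+n]*nCk (suc n) zero    =
  trans (ℕ.*-identityˡ _) (trans (nC1≡n (2 ℕ.+ n)) (sym (ℕ.*-identityʳ (2 ℕ.+ n))))
[1+k]*[1+n]C[1+k]≡[1+n]*nCk (suc n) (suc k) = begin
  (2 ℕ.+ k) ℕ.* ((2 ℕ.+ n) C (2 ℕ.+ k))
    ≡⟨ cong ((2 ℕ.+ k) ℕ.*_) (nCk+nC[k+1]≡[n+1]C[k+1] (suc n) (suc k)) ⟨
  (2 ℕ.+ k) ℕ.* (X ℕ.+ Y)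
    ≡⟨ ℕ.*-distribˡ-+ (2 ℕ.+ k) X Y ⟩
  (X ℕ.+ (1 ℕ.+ k) ℕ.* X) ℕ.+ (2 ℕ.+ k) ℕ.* Y
    ≡⟨ cong₂ (λ a b → X ℕ.+ a ℕ.+ b) ([1+k]*[1+n]C[1+k]≡[1+n]*nCk n k)
                                     ([1+k]*[1+n]C[1+k]≡[1+n]*nCk n (suc k)) ⟩
  (X ℕ.+ (1 ℕ.+ n) ℕ.* A) ℕ.+ (1 ℕ.+ n) ℕ.* B
    ≡⟨ ℕ.+-assoc X _ _ ⟩
  X ℕ.+ ((1 ℕ.+ n) ℕ.* A ℕ.+ (1 ℕ.+ n) ℕ.* B)
    ≡⟨ cong (X ℕ.+_) (ℕ.*-distribˡ-+ (1 ℕ.+ n) A B) ⟨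
  X ℕ.+ (1 ℕ.+ n) ℕ.* (A ℕ.+ B)
    ≡⟨ cong (λ c → X ℕ.+ (1 ℕ.+ n) ℕ.* c) (nCk+nC[k+1]≡[n+1]C[k+1] n k) ⟩
  (2 ℕ.+ n) ℕ.* X
    ∎
  where
  open ≡-Reasoning
  X = suc n C suc k
  Y = suc n C suc (suc k)
  A = n C k
  B = n C suc k

frac-binomial : ∀ t l → frac (suc t ℕ.+ suc l) (suc t) * ι (suc t C suc l) ≡ ι (suc t C suc l) + ι (t C l)
frac-binomial t l = trans (frac-*-ι (suc t ℕ.+ suc l) t c (c ℕ.+ d) absorb) (ι-+ c d)
  where
  c = suc t C suc l
  d = t C l
  absorb : (suc t ℕ.+ suc l) ℕ.* c ≡ suc t ℕ.* (c ℕ.+ d)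
  absorb = begin
    (suc t ℕ.+ suc l) ℕ.* c       ≡⟨ ℕ.*-distribʳ-+ c (suc t) (suc l) ⟩
    suc t ℕ.* c ℕ.+ suc l ℕ.* c   ≡⟨ cong (suc t ℕ.* c ℕ.+_) ([1+k]*[1+n]C[1+k]≡[1+n]*nCk t l) ⟩
    suc t ℕ.* c ℕ.+ suc t ℕ.* d   ≡⟨ ℕ.*-distribˡ-+ (suc t) c d ⟨
    suc t ℕ.* (c ℕ.+ d)           ∎
    where open ≡-Reasoning

Recurrent : ℚ → (ℕ → ℚ) → Set
Recurrent y u = ∀ m → u (3 ℕ.+ m) ≡ y * u (2 ℕ.+ m) + u m

recurrent-+ : ∀ {y u v} → Recurrent y u → Recurrent y v → Recurrent y (λ m → u m + v m)
recurrent-+ {y} {u} {v} rec-u rec-v m = begin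
  u (3 ℕ.+ m) + v (3 ℕ.+ m)                              ≡⟨ cong₂ _+_ (rec-u m) (rec-v m) ⟩
  (y * u (2 ℕ.+ m) + u m) + (y * v (2 ℕ.+ m) + v m)      ≡⟨ interchange (y * u (2 ℕ.+ m)) (u m) _ (v m) ⟩
  (y * u (2 ℕ.+ m) + y * v (2 ℕ.+ m)) + (u m + v m)      ≡⟨ cong (_+ (u m + v m)) (ℚ.*-distribˡ-+ y _ _) ⟨
  y * (u (2 ℕ.+ m) + v (2 ℕ.+ m)) + (u m + v m)          ∎
  where open ≡-Reasoning

recurrent-unique : ∀ {y u v} → Recurrent y u → Recurrent y v →
                   u 0 ≡ v 0 → u 1 ≡ v 1 → u 2 ≡ v 2 → u ≗ v
recurrent-unique {y} {u} {v} rec-u rec-v u0≡v0 u1≡v1 u2≡v2 = go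
  where
  go : u ≗ v
  go 0 = u0≡v0
  go 1 = u1≡v1
  go 2 = u2≡v2
  go (suc (suc (suc m))) =
    trans (rec-u m) (trans (cong₂ (λ a b → y * a + b) (go (suc (suc m))) (go m)) (sym (rec-v m)))

m≡n+o⇒m∸n≡o : ∀ {m} n o → m ≡ n ℕ.+ o → m ∸ n ≡ o
m≡n+o⇒m∸n≡o n o refl = ℕ.m+n∸m≡n n o

[1+m]∸n∸1≡o : ∀ {m} n o → m ≡ n ℕ.+ o → suc m ∸ n ∸ 1 ≡ o
[1+m]∸n∸1≡o {m} n o m≡n+o = begin
  suc m ∸ n ∸ 1     ≡⟨ ℕ.∸-+-assoc (suc m) n 1 ⟩
  suc m ∸ (n ℕ.+ 1) ≡⟨ cong (suc m ∸_) (ℕ.+-comm n 1) ⟩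
  m ∸ n             ≡⟨ m≡n+o⇒m∸n≡o n o m≡n+o ⟩
  o                 ∎
  where open ≡-Reasoning

3ℓ+r≡2ℓ+[ℓ+r] : ∀ ℓ r → 3 ℕ.* ℓ ℕ.+ r ≡ 2 ℕ.* ℓ ℕ.+ (ℓ ℕ.+ r)
3ℓ+r≡2ℓ+[ℓ+r] = solve-∀

m≤n⇒m<3*[1+n] : ∀ {m n} → m ≤ n → m < 3 ℕ.* suc n
m≤n⇒m<3*[1+n] {n = n} m≤n = ℕ.≤-trans (s≤s m≤n) (ℕ.m≤m+n (suc n) (2 ℕ.* suc n))

m<3*[1+m/3] : ∀ m → m < 3 ℕ.* suc (m ℕ./ 3)
m<3*[1+m/3] m = begin-strict
  m                          ≡⟨ ℕ.m≡m%n+[m/n]*n m 3 ⟩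
  m ℕ.% 3 ℕ.+ m ℕ./ 3 ℕ.* 3  <⟨ ℕ.+-monoˡ-< _ (ℕ.m%n<n m 3) ⟩
  3 ℕ.+ m ℕ./ 3 ℕ.* 3        ≡⟨ cong (3 ℕ.+_) (ℕ.*-comm (m ℕ./ 3) 3) ⟩
  3 ℕ.+ 3 ℕ.* (m ℕ./ 3)      ≡⟨ ℕ.*-suc 3 (m ℕ./ 3) ⟨
  3 ℕ.* suc (m ℕ./ 3)        ∎
  where open ℕ.≤-Reasoning

ℓ<1+m/3⇒3ℓ≤m : ∀ {m ℓ} → ℓ < suc (m ℕ./ 3) → 3 ℕ.* ℓ ≤ m
ℓ<1+m/3⇒3ℓ≤m {m} (s≤s ℓ≤m/3) =
  ℕ.≤-trans (ℕ.*-monoʳ-≤ 3 ℓ≤m/3) (subst (ℕ._≤ m) (ℕ.*-comm (m ℕ./ 3) 3) (ℕ.m/n*n≤m m 3))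

module _ (y : ℚ) where

  narayanaTerm : ℕ → ℕ → ℚ
  narayanaTerm m ℓ = y ^ (m ∸ 3 ℕ.* ℓ) * ι ((m ∸ 2 ℕ.* ℓ) C ℓ)

  -- At y = 1 these are Narayana's cows numbers 1, 1, 1, 2, 3, 4, 6, 9, ….
  narayana : ℕ → ℚ
  narayana m = Σ (narayanaTerm m) (suc m)

  narayanaTerm-vanish : ∀ {m ℓ} → m < 3 ℕ.* ℓ → narayanaTerm m ℓ ≡ 0ℚ
  narayanaTerm-vanish {m} {ℓ@(suc _)} m<3ℓ =
    trans (cong (y ^ (m ∸ 3 ℕ.* ℓ) *_) (trans (cong ι (k>n⇒nCk≡0 m∸2ℓ<ℓ)) ι-0))
          (ℚ.*-zeroʳ (y ^ (m ∸ 3 ℕ.* ℓ)))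
    where
    m∸2ℓ<ℓ : m ∸ 2 ℕ.* ℓ < ℓ
    m∸2ℓ<ℓ = ℕ.m<n+o⇒m∸n<o m (2 ℕ.* ℓ) (subst (m <_) (ℕ.+-comm ℓ (2 ℕ.* ℓ)) m<3ℓ)

  narayanaTerm-at : ∀ {m} ℓ r → m ≡ 3 ℕ.* ℓ ℕ.+ r → narayanaTerm m ℓ ≡ y ^ r * ι ((ℓ ℕ.+ r) C ℓ)
  narayanaTerm-at ℓ r refl = cong₂ (λ e n → y ^ e * ι (n C ℓ))
    (ℕ.m+n∸m≡n (3 ℕ.* ℓ) r) (m≡n+o⇒m∸n≡o (2 ℕ.* ℓ) (ℓ ℕ.+ r) (3ℓ+r≡2ℓ+[ℓ+r] ℓ r))

  narayanaTerm-diag : ∀ {m} ℓ → m ≡ 3 ℕ.* ℓ → narayanaTerm m ℓ ≡ 1ℚ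
  narayanaTerm-diag ℓ m≡3ℓ = trans (narayanaTerm-at ℓ 0 (trans m≡3ℓ (sym (ℕ.+-identityʳ _))))
    (cong (1ℚ *_) (trans (cong (λ n → ι (n C ℓ)) (ℕ.+-identityʳ ℓ)) (trans (cong ι (nCn≡1 ℓ)) ι-1)))

  narayanaTerm-vanish-from : ∀ {m K} → m < 3 ℕ.* K → ∀ ℓ → K ≤ ℓ → narayanaTerm m ℓ ≡ 0ℚ
  narayanaTerm-vanish-from {m} m<3K ℓ K≤ℓ =
    narayanaTerm-vanish {m} {ℓ} (ℕ.<-≤-trans m<3K (ℕ.*-monoʳ-≤ 3 K≤ℓ))

  narayana-Σ : ∀ m K → m < 3 ℕ.* K → Σ (narayanaTerm m) K ≡ narayana m
  narayana-Σ m K m<3K with ℕ.≤-total K (suc m)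
  ... | inj₁ K≤1+m = sym (Σ-extend (narayanaTerm m) (narayanaTerm-vanish-from m<3K) K≤1+m)
  ... | inj₂ 1+m≤K =
    Σ-extend (narayanaTerm m) (narayanaTerm-vanish-from (m≤n⇒m<3*[1+n] ℕ.≤-refl)) 1+m≤K

  narayanaTerm-pascal-at : ∀ l r →
    narayanaTerm (3 ℕ.+ (3 ℕ.* l ℕ.+ r)) (suc l)
      ≡ y * narayanaTerm (2 ℕ.+ (3 ℕ.* l ℕ.+ r)) (suc l) + narayanaTerm (3 ℕ.* l ℕ.+ r) l
  narayanaTerm-pascal-at l zero = begin
    narayanaTerm (3 ℕ.+ (3 ℕ.* l ℕ.+ 0)) (suc l)       ≡⟨ narayanaTerm-diag (suc l) (3+[3l+0]≡3[1+l] l) ⟩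
    1ℚ                                                 ≡⟨ cong (_+ 1ℚ) (ℚ.*-zeroʳ y) ⟨
    y * 0ℚ + 1ℚ                                        ≡⟨ cong₂ (λ a b → y * a + b)
      (narayanaTerm-vanish {2 ℕ.+ (3 ℕ.* l ℕ.+ 0)} {suc l} (ℕ.≤-reflexive (3+[3l+0]≡3[1+l] l)))
      (narayanaTerm-diag l (ℕ.+-identityʳ (3 ℕ.* l))) ⟨
    y * narayanaTerm (2 ℕ.+ (3 ℕ.* l ℕ.+ 0)) (suc l) + narayanaTerm (3 ℕ.* l ℕ.+ 0) l ∎
    where
    open ≡-Reasoning
    3+[3l+0]≡3[1+l] : ∀ l → 3 ℕ.+ (3 ℕ.* l ℕ.+ 0) ≡ 3 ℕ.* suc l
    3+[3l+0]≡3[1+l] = solve-∀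
  narayanaTerm-pascal-at l (suc r) = begin
    narayanaTerm (3 ℕ.+ (3 ℕ.* l ℕ.+ suc r)) (suc l)   ≡⟨ narayanaTerm-at (suc l) (suc r) (3+[3l+1+r]≡3[1+l]+1+r l r) ⟩
    y ^ suc r * ι ((suc l ℕ.+ suc r) C suc l)         ≡⟨ cong (λ c → y ^ suc r * ι c) pascal ⟩
    y ^ suc r * ι (a ℕ.+ b)                           ≡⟨ cong (y ^ suc r *_) (ι-+ a b) ⟩
    y ^ suc r * (ι a + ι b)                           ≡⟨ ℚ.*-distribˡ-+ (y ^ suc r) (ι a) (ι b) ⟩
    y ^ suc r * ι a + y ^ suc r * ι b                 ≡⟨ ℚ.+-comm (y ^ suc r * ι a) (y ^ suc r * ι b) ⟩
    y ^ suc r * ι b + y ^ suc r * ι a                 ≡⟨ cong (_+ y ^ suc r * ι a) (ℚ.*-assoc y (y ^ r) (ι b)) ⟩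
    y * (y ^ r * ι b) + y ^ suc r * ι a               ≡⟨ cong₂ (λ p q → y * p + q)
      (narayanaTerm-at (suc l) r (2+[3l+1+r]≡3[1+l]+r l r))
      (narayanaTerm-at l (suc r) refl) ⟨
    y * narayanaTerm (2 ℕ.+ (3 ℕ.* l ℕ.+ suc r)) (suc l) + narayanaTerm (3 ℕ.* l ℕ.+ suc r) l ∎
    where
    open ≡-Reasoning
    a = (l ℕ.+ suc r) C l
    b = (suc l ℕ.+ r) C suc l
    pascal : (suc l ℕ.+ suc r) C suc l ≡ a ℕ.+ b
    pascal = trans (sym (nCk+nC[k+1]≡[n+1]C[k+1] (l ℕ.+ suc r) l))
                   (cong (λ n → a ℕ.+ n C suc l) (ℕ.+-suc l r))
    3+[3l+1+r]≡3[1+l]+1+r : ∀ l r → 3 ℕ.+ (3 ℕ.* l ℕ.+ suc r) ≡ 3 ℕ.* suc l ℕ.+ suc r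
    3+[3l+1+r]≡3[1+l]+1+r = solve-∀
    2+[3l+1+r]≡3[1+l]+r : ∀ l r → 2 ℕ.+ (3 ℕ.* l ℕ.+ suc r) ≡ 3 ℕ.* suc l ℕ.+ r
    2+[3l+1+r]≡3[1+l]+r = solve-∀

  narayanaTerm-pascal : ∀ m ℓ →
    narayanaTerm (3 ℕ.+ m) ℓ ≡ y * narayanaTerm (2 ℕ.+ m) ℓ + shift (narayanaTerm m) ℓ
  narayanaTerm-pascal m zero = trans (ℚ.*-assoc y (y ^ (2 ℕ.+ m)) (ι 1)) (sym (ℚ.+-identityʳ _))
  narayanaTerm-pascal m (suc l) with ℕ.≤-<-connex (3 ℕ.* l) m
  ... | inj₁ 3l≤m with r , refl ← ℕ.m≤n⇒∃[o]m+o≡n 3l≤m = narayanaTerm-pascal-at l r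
  ... | inj₂ m<3l = begin
    narayanaTerm (3 ℕ.+ m) (suc l)                         ≡⟨ narayanaTerm-vanish {3 ℕ.+ m} {suc l} 3+m<3[1+l] ⟩
    0ℚ                                                     ≡⟨ cong (_+ 0ℚ) (ℚ.*-zeroʳ y) ⟨
    y * 0ℚ + 0ℚ                                            ≡⟨ cong₂ (λ a b → y * a + b)
      (narayanaTerm-vanish {2 ℕ.+ m} {suc l} (ℕ.<-trans (ℕ.n<1+n _) 3+m<3[1+l]))
      (narayanaTerm-vanish {m} {l} m<3l) ⟨
    y * narayanaTerm (2 ℕ.+ m) (suc l) + narayanaTerm m l  ∎
    where
    open ≡-Reasoning
    3+m<3[1+l] : 3 ℕ.+ m < 3 ℕ.* suc l
    3+m<3[1+l] = subst (3 ℕ.+ m <_) (sym (ℕ.*-suc 3 l)) (ℕ.+-monoʳ-< 3 m<3l)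

  narayana-recurrent : Recurrent y narayana
  narayana-recurrent m = begin
    Σ (narayanaTerm (3 ℕ.+ m)) (4 ℕ.+ m)
      ≡⟨ Σ-cong (4 ℕ.+ m) (λ ℓ _ → narayanaTerm-pascal m ℓ) ⟩
    Σ (λ ℓ → y * narayanaTerm (2 ℕ.+ m) ℓ + shift (narayanaTerm m) ℓ) (4 ℕ.+ m)
      ≡⟨ Σ-distrib-+ (λ ℓ → y * narayanaTerm (2 ℕ.+ m) ℓ) (shift (narayanaTerm m)) (4 ℕ.+ m) ⟩
    Σ (λ ℓ → y * narayanaTerm (2 ℕ.+ m) ℓ) (4 ℕ.+ m) + Σ (shift (narayanaTerm m)) (4 ℕ.+ m)
      ≡⟨ cong₂ _+_ (sym (*-distribˡ-Σ y (narayanaTerm (2 ℕ.+ m)) (4 ℕ.+ m))) (Σ-shift (narayanaTerm m) (3 ℕ.+ m)) ⟩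
    y * Σ (narayanaTerm (2 ℕ.+ m)) (4 ℕ.+ m) + Σ (narayanaTerm m) (3 ℕ.+ m)
      ≡⟨ cong₂ (λ a b → y * a + b) (narayana-Σ (2 ℕ.+ m) (4 ℕ.+ m) (m≤n⇒m<3*[1+n] (ℕ.n≤1+n _)))
                                   (narayana-Σ m (3 ℕ.+ m) (m≤n⇒m<3*[1+n] (ℕ.m≤n+m m 2))) ⟩
    y * narayana (2 ℕ.+ m) + narayana m
      ∎
    where open ≡-Reasoning

  narayana-<3 : ∀ m → m < 3 → narayana m ≡ y ^ m
  narayana-<3 m m<3 = begin
    narayana m                    ≡⟨ narayana-Σ m 1 m<3 ⟨
    y ^ m * ι 1 + 0ℚ              ≡⟨ ℚ.+-identityʳ _ ⟩
    y ^ m * ι 1                   ≡⟨ cong (y ^ m *_) ι-1 ⟩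
    y ^ m * 1ℚ                    ≡⟨ ℚ.*-identityʳ (y ^ m) ⟩
    y ^ m                         ∎
    where open ≡-Reasoning

  -- N_{m-3}, with N continued backwards along the recurrence: N_{-3} = 1, N_{-2} = N_{-1} = 0.
  narayana′ : ℕ → ℚ
  narayana′ 0 = 1ℚ
  narayana′ 1 = 0ℚ
  narayana′ 2 = 0ℚ
  narayana′ (suc (suc (suc m))) = narayana m

  narayana′-recurrent : Recurrent y narayana′
  narayana′-recurrent 0 = trans (narayana-<3 0 (s≤s z≤n)) (cong (_+ 1ℚ) (sym (ℚ.*-zeroʳ y)))
  narayana′-recurrent 1 = trans (narayana-<3 1 (s≤s (s≤s z≤n)))
    (trans (cong (y *_) (sym (narayana-<3 0 (s≤s z≤n)))) (sym (ℚ.+-identityʳ _)))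
  narayana′-recurrent 2 = trans (narayana-<3 2 ℕ.≤-refl)
    (trans (cong (y *_) (sym (narayana-<3 1 (s≤s (s≤s z≤n))))) (sym (ℚ.+-identityʳ _)))
  narayana′-recurrent (suc (suc (suc m))) = narayana-recurrent m

  narayana′-Σ : ∀ m → 0 < m → Σ (narayanaTerm (m ∸ 3)) (m ℕ./ 3) ≡ narayana′ m
  narayana′-Σ 1 _ = refl
  narayana′-Σ 2 _ = refl
  narayana′-Σ (suc (suc (suc m))) _ =
    trans (cong (Σ (narayanaTerm m)) (ℕ.m/n≡1+[m∸n]/n {3 ℕ.+ m} {3} (s≤s (s≤s (s≤s z≤n)))))
          (narayana-Σ m (suc (m ℕ./ 3)) (m<3*[1+m/3] m))

module _ (x : ℚ) where

  private
    y : ℚ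
    y = 2ℚ * x

  term-at : ∀ ℓ r → term (suc (3 ℕ.* ℓ ℕ.+ r)) x ℓ
                    ≡ y ^ r * (frac (ℓ ℕ.+ r ℕ.+ ℓ) (ℓ ℕ.+ r) * ι ((ℓ ℕ.+ r) C ℓ))
  term-at ℓ r = begin
    term (suc M) x ℓ
      ≡⟨ cong (λ c → y ^ (M ∸ 3 ℕ.* ℓ) * (frac (suc M ∸ ℓ ∸ 1) (suc M ∸ 2 ℕ.* ℓ ∸ 1) * c)) (ι-def _) ⟨
    f (M ∸ 3 ℕ.* ℓ) (suc M ∸ ℓ ∸ 1) (suc M ∸ 2 ℕ.* ℓ ∸ 1)
      ≡⟨ cong (λ e → f e (suc M ∸ ℓ ∸ 1) (suc M ∸ 2 ℕ.* ℓ ∸ 1)) (ℕ.m+n∸m≡n (3 ℕ.* ℓ) r) ⟩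
    f r (suc M ∸ ℓ ∸ 1) (suc M ∸ 2 ℕ.* ℓ ∸ 1)
      ≡⟨ cong₂ (f r) ([1+m]∸n∸1≡o ℓ (ℓ ℕ.+ r ℕ.+ ℓ) (3ℓ+r≡ℓ+[ℓ+r+ℓ] ℓ r))
                     ([1+m]∸n∸1≡o (2 ℕ.* ℓ) (ℓ ℕ.+ r) (3ℓ+r≡2ℓ+[ℓ+r] ℓ r)) ⟩
    f r (ℓ ℕ.+ r ℕ.+ ℓ) (ℓ ℕ.+ r)
      ∎
    where
    open ≡-Reasoning
    M = 3 ℕ.* ℓ ℕ.+ r
    f : ℕ → ℕ → ℕ → ℚ
    f e a b = y ^ e * (frac a b * ι (b C ℓ))
    3ℓ+r≡ℓ+[ℓ+r+ℓ] : ∀ ℓ r → 3 ℕ.* ℓ ℕ.+ r ≡ ℓ ℕ.+ (ℓ ℕ.+ r ℕ.+ ℓ)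
    3ℓ+r≡ℓ+[ℓ+r+ℓ] = solve-∀

  term-split : ∀ m ℓ r → m ≡ 3 ℕ.* ℓ ℕ.+ r → 0 < m →
               term (suc m) x ℓ ≡ narayanaTerm y m ℓ + shift (narayanaTerm y (m ∸ 3)) ℓ
  term-split _ zero (suc r) refl _ = begin
    term (suc (suc r)) x 0                              ≡⟨ term-at 0 (suc r) ⟩
    y ^ suc r * (frac (suc r ℕ.+ 0) (suc r) * ι c)      ≡⟨ cong (y ^ suc r *_) (frac-*-ι (suc r ℕ.+ 0) r c c
                                                             (cong (ℕ._* c) (ℕ.+-identityʳ (suc r)))) ⟩
    y ^ suc r * ι c                                     ≡⟨ ℚ.+-identityʳ _ ⟨
    y ^ suc r * ι c + 0ℚ                                ∎
    where
    open ≡-Reasoning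
    c = suc r C 0
  term-split _ (suc l) r refl _ = begin
    term (suc M) x (suc l)                                        ≡⟨ term-at (suc l) r ⟩
    y ^ r * (frac (suc t ℕ.+ suc l) (suc t) * ι (suc t C suc l))  ≡⟨ cong (y ^ r *_) (frac-binomial t l) ⟩
    y ^ r * (ι (suc t C suc l) + ι (t C l))                       ≡⟨ ℚ.*-distribˡ-+ (y ^ r) _ _ ⟩
    y ^ r * ι (suc t C suc l) + y ^ r * ι (t C l)                 ≡⟨ cong₂ _+_
                                                                       (narayanaTerm-at y (suc l) r refl)
                                                                       (narayanaTerm-at y l r M∸3≡3l+r) ⟨
    narayanaTerm y M (suc l) + narayanaTerm y (M ∸ 3) l           ∎
    where
    open ≡-Reasoning
    M = 3 ℕ.* suc l ℕ.+ r
    t = l ℕ.+ r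
    3[1+l]+r≡3+[3l+r] : ∀ l r → 3 ℕ.* suc l ℕ.+ r ≡ 3 ℕ.+ (3 ℕ.* l ℕ.+ r)
    3[1+l]+r≡3+[3l+r] = solve-∀
    M∸3≡3l+r : M ∸ 3 ≡ 3 ℕ.* l ℕ.+ r
    M∸3≡3l+r = m≡n+o⇒m∸n≡o 3 (3 ℕ.* l ℕ.+ r) (3[1+l]+r≡3+[3l+r] l r)

  rhs-split : ∀ m → 0 < m → rhs (suc m) x ≡ narayana y m + Σ (narayanaTerm y (m ∸ 3)) (m ℕ./ 3)
  rhs-split m 0<m = begin
    rhs (suc m) x
      ≡⟨ sumℚ-map-applyUpTo (term (suc m) x) (λ ℓ → ℓ) K ⟩
    Σ (term (suc m) x) K
      ≡⟨ Σ-cong K split ⟩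
    Σ (λ ℓ → narayanaTerm y m ℓ + shift (narayanaTerm y (m ∸ 3)) ℓ) K
      ≡⟨ Σ-distrib-+ (narayanaTerm y m) (shift (narayanaTerm y (m ∸ 3))) K ⟩
    Σ (narayanaTerm y m) K + Σ (shift (narayanaTerm y (m ∸ 3))) K
      ≡⟨ cong₂ _+_ (narayana-Σ y m K (m<3*[1+m/3] m)) (Σ-shift (narayanaTerm y (m ∸ 3)) (m ℕ./ 3)) ⟩
    narayana y m + Σ (narayanaTerm y (m ∸ 3)) (m ℕ./ 3)
      ∎
    where
    open ≡-Reasoning
    K = suc (m ℕ./ 3)
    split : ∀ ℓ → ℓ < K → term (suc m) x ℓ ≡ narayanaTerm y m ℓ + shift (narayanaTerm y (m ∸ 3)) ℓ
    split ℓ ℓ<K = let r , 3ℓ+r≡m = ℕ.m≤n⇒∃[o]m+o≡n (ℓ<1+m/3⇒3ℓ≤m ℓ<K) in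
                  term-split m ℓ r (sym 3ℓ+r≡m) 0<m

  s-recurrent : Recurrent y (λ m → s (suc m) x)
  s-recurrent _ = refl

  s≡narayana+narayana′ : ∀ m → s (suc m) x ≡ narayana y m + narayana′ y m
  s≡narayana+narayana′ = recurrent-unique {y} s-recurrent
    (recurrent-+ {y} {narayana y} {narayana′ y} (narayana-recurrent y) (narayana′-recurrent y))
    (cong (_+ 1ℚ) (sym (narayana-<3 y 0 (s≤s z≤n))))
    (sym (trans (ℚ.+-identityʳ _) (trans (narayana-<3 y 1 (s≤s (s≤s z≤n))) (ℚ.*-identityʳ y))))
    (cong (_+ 0ℚ) (trans (cong (y *_) (sym (ℚ.*-identityʳ y))) (sym (narayana-<3 y 2 ℕ.≤-refl))))

mainTheorem5 : (n : ℕ) → 2 ≤ n → (x : ℚ) → s n x ≡ rhs n x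
mainTheorem5 (suc m) (s≤s 0<m) x = begin
  s (suc m) x                                              ≡⟨ s≡narayana+narayana′ x m ⟩
  narayana y m + narayana′ y m                             ≡⟨ cong (narayana y m +_) (narayana′-Σ y m 0<m) ⟨
  narayana y m + Σ (narayanaTerm y (m ∸ 3)) (m ℕ./ 3)      ≡⟨ rhs-split x m 0<m ⟨
  rhs (suc m) x                                            ∎
  where
  open ≡-Reasoning
  y = 2ℚ * x
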